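{- Let $D=(V,A)$ be a loopless, weakly connected digraph with at least two nodes, let $D^*=(V^*,A^*)$ and $c^*$ be as defined in the context, let $\pi^*$ be an integer-valued $c^*$-feasible potential on $V^*$, and let $y^*:=c^*-\Delta_{\pi^*}$ on $A^*$. Then for every node $v\in V$, $y^*(v_{\rm i}v)+y^*(vv_{\rm o})\in\{0,1\}$; in particular $y^*(v_{\rm i}v)\in\{0,1\}$ and $y^*(vv_{\rm o})\in\{0,1\}$.
   Context: Let $\overleftrightarrow{A}=A\cup\overleftarrow{A}$ where $\overleftarrow{A}$ consists of the reverses of the arcs of $A$. Let $V_{\rm o}=\{v_{\rm o}:v\in V\}$ and $V_{\rm i}=\{v_{\rm i}:v\in V\}$ be disjoint copies of $V$ and $V^*=V_{\rm o}\cup V\cup V_{\rm i}$. The arc set $A^*$ consists of the vertical arcs $v_{\rm i}v$ and $vv_{\rm o}$ for each $v\in V$, and, for each arc $uv\in\overleftrightarrow{A}$, the arcs $uv$, $uv_{\rm i}$, $u_{\rm o}v$. The cost $c^*:A^*\to\{0,1\}$ is $1$ on the arcs $uv$, $uv_{\rm i}$, $u_{\rm o}v$ with $uv\in A$, and $0$ on all other arcs. For a potential $\pi^*$ on $V^*$, $\Delta_{\pi^*}(a)=\pi^*(\text{head}(a))-\pi^*(\text{tail}(a))$; $\pi^*$ is $c^*$-feasible if $\Delta_{\pi^*}(a)\le c^*(a)$ for all $a\in A^*$ (so $y^*\ge 0$). -}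

module Defs where

open import Data.Nat using (ℕ; _≤_)
open import Data.Fin using (Fin)
open import Data.Integer using (ℤ; _-_; _+_) renaming (_≤_ to _≤ℤ_)
open import Data.Product using (Σ; _×_; ∃; ∃-syntax)
open import Data.Sum using (_⊎_)
open import Relation.Binary.PropositionalEquality using (_≡_)
open import Relation.Nullary using (¬_)
open import Relation.Binary.Construct.Closure.ReflexiveTransitive using (Star)

record Digraph : Set where
  field
    n    : ℕ
    m    : ℕ
    tail : Fin m → Fin n
    head : Fin m → Fin n
open Digraph public

Loopless : Digraph → Set
Loopless D = ∀ (a : Fin (m D)) → ¬ (tail D a ≡ head D a)

UAdj : (D : Digraph) → Fin (n D) → Fin (n D) → Set
UAdj D u v = ∃[ a ] ((tail D a ≡ u × head D a ≡ v) ⊎ (head D a ≡ u × tail D a ≡ v))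

WeaklyConnected : Digraph → Set
WeaklyConnected D = ∀ (u v : Fin (n D)) → Star (UAdj D) u v

-- Nodes of D* : V_o ∪ V ∪ V_i
data V* (D : Digraph) : Set where
  out  : Fin (n D) → V* D
  mid  : Fin (n D) → V* D
  inn  : Fin (n D) → V* D

-- Arcs of ↔A = A ∪ reverse(A): fwd a is the arc a itself, bwd a its reverse
data ↔Arc (D : Digraph) : Set where
  fwd : Fin (m D) → ↔Arc D
  bwd : Fin (m D) → ↔Arc D

↔tail ↔head : (D : Digraph) → ↔Arc D → Fin (n D)
↔tail D (fwd a) = tail D a
↔tail D (bwd a) = head D a
↔head D (fwd a) = head D a
↔head D (bwd a) = tail D a

↔cost : (D : Digraph) → ↔Arc D → ℤ
↔cost D (fwd _) = Data.Integer.+ 1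
↔cost D (bwd _) = Data.Integer.+ 0

data A* (D : Digraph) : Set where
  vin  : Fin (n D) → A* D
  vout : Fin (n D) → A* D
  uv   : ↔Arc D → A* D
  uvi  : ↔Arc D → A* D
  uov  : ↔Arc D → A* D

tail* head* : (D : Digraph) → A* D → V* D
tail* D (vin v)  = inn v
tail* D (vout v) = mid v
tail* D (uv e)   = mid (↔tail D e)
tail* D (uvi e)  = mid (↔tail D e)
tail* D (uov e)  = out (↔tail D e)
head* D (vin v)  = mid v
head* D (vout v) = out v
head* D (uv e)   = mid (↔head D e)
head* D (uvi e)  = inn (↔head D e)
head* D (uov e)  = mid (↔head D e)

c* : (D : Digraph) → A* D → ℤ
c* D (vin _)  = Data.Integer.+ 0
c* D (vout _) = Data.Integer.+ 0
c* D (uv e)   = ↔cost D e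
c* D (uvi e)  = ↔cost D e
c* D (uov e)  = ↔cost D e

Δ : (D : Digraph) → (V* D → ℤ) → A* D → ℤ
Δ D π a = π (head* D a) - π (tail* D a)

Feasible : (D : Digraph) → (V* D → ℤ) → Set
Feasible D π = ∀ (a : A* D) → Δ D π a ≤ℤ c* D a

y* : (D : Digraph) → (V* D → ℤ) → A* D → ℤ
y* D π a = c* D a - Δ D π a

In01 : ℤ → Set
In01 z = z ≡ Data.Integer.+ 0 ⊎ z ≡ Data.Integer.+ 1

{-# OPTIONS --safe #-}
module Submission where

-- Every node v has a neighbour u, so D* contains the cycle
-- v_i → v → v_o → u → v_i, in which the arcs v_o u and u v_i come from the two
-- orientations of one arc of A and hence have costs summing to 1. Since Δ sums
-- to 0 around a cycle, y*(v_i v) + y*(v v_o) = Δ(v_o u) + Δ(u v_i) ≤ 1, and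
-- feasibility makes both summands nonnegative integers.

open import Defs
open import Data.Nat using (_≤_; zero; suc; s≤s)
open import Data.Fin using (Fin; zero; suc)
open import Data.Integer using (ℤ; _+_; _-_; +_; -[1+_]; +≤+) renaming (_≤_ to _≤ℤ_)
open import Data.Integer.Properties using (i≤j⇒0≤j-i; +-mono-≤; module ≤-Reasoning)
open import Data.Integer.Tactic.RingSolver using (solve-∀)
open import Data.Product using (_×_; _,_; ∃)
open import Data.Sum using (inj₁; inj₂)
open import Data.Empty using (⊥-elim)
open import Relation.Binary.PropositionalEquality using (_≡_; _≢_; refl)
open import Relation.Binary.Construct.Closure.ReflexiveTransitive using (ε; _◅_)

nonneg-sum≤1⇒In01 : {p q : ℤ} → + 0 ≤ℤ p → + 0 ≤ℤ q → p + q ≤ℤ + 1 →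
  In01 (p + q) × In01 p × In01 q
nonneg-sum≤1⇒In01 {+ 0}           {+ 0}           _ _ _ = inj₁ refl , inj₁ refl , inj₁ refl
nonneg-sum≤1⇒In01 {+ 0}           {+ 1}           _ _ _ = inj₂ refl , inj₁ refl , inj₂ refl
nonneg-sum≤1⇒In01 {+ 1}           {+ 0}           _ _ _ = inj₂ refl , inj₂ refl , inj₁ refl
nonneg-sum≤1⇒In01 {+ 0}           {+ suc (suc _)} _ _ (+≤+ (s≤s ()))
nonneg-sum≤1⇒In01 {+ 1}           {+ suc _}       _ _ (+≤+ (s≤s ()))
nonneg-sum≤1⇒In01 {+ suc (suc _)} {+ _}           _ _ (+≤+ (s≤s ()))
nonneg-sum≤1⇒In01 {+ _}           { -[1+ _ ]}     _ () _
nonneg-sum≤1⇒In01 { -[1+ _ ]}     {_}             () _ _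

∃-≢ : ∀ {k} → 2 ≤ k → (v : Fin k) → ∃ λ w → v ≢ w
∃-≢ {suc zero}    (s≤s ()) zero
∃-≢ {suc (suc _)} _ zero    = suc zero , λ ()
∃-≢ {suc (suc _)} _ (suc _) = zero , λ ()

∃-↔Arc-from : (D : Digraph) → WeaklyConnected D → 2 ≤ n D →
  (v : Fin (n D)) → ∃ λ e → ↔tail D e ≡ v
∃-↔Arc-from D connected 2≤n v with ∃-≢ 2≤n v
... | w , v≢w with connected v w
...   | ε                           = ⊥-elim (v≢w refl)
...   | (a , inj₁ (tail≡v , _)) ◅ _ = fwd a , tail≡v
...   | (a , inj₂ (head≡v , _)) ◅ _ = bwd a , head≡v

↔reverse : (D : Digraph) → ↔Arc D → ↔Arc D
↔reverse D (fwd a) = bwd a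
↔reverse D (bwd a) = fwd a

↔cost-+-↔cost-reverse : (D : Digraph) (e : ↔Arc D) → ↔cost D e + ↔cost D (↔reverse D e) ≡ + 1
↔cost-+-↔cost-reverse D (fwd _) = refl
↔cost-+-↔cost-reverse D (bwd _) = refl

↔tail-reverse : (D : Digraph) (e : ↔Arc D) → ↔tail D (↔reverse D e) ≡ ↔head D e
↔tail-reverse D (fwd _) = refl
↔tail-reverse D (bwd _) = refl

↔head-reverse : (D : Digraph) (e : ↔Arc D) → ↔head D (↔reverse D e) ≡ ↔tail D e
↔head-reverse D (fwd _) = refl
↔head-reverse D (bwd _) = refl

y*-nonneg : (D : Digraph) (π : V* D → ℤ) → Feasible D π → (a : A* D) → + 0 ≤ℤ y* D π a
y*-nonneg D π feasible a = i≤j⇒0≤j-i (feasible a)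

four-cycle-telescopes : (a b c x : ℤ) → (+ 0 - (b - a)) + (+ 0 - (c - b)) ≡ (x - c) + (a - x)
four-cycle-telescopes = solve-∀

y*-vertical-sum≡Δ-return-path : (D : Digraph) (π : V* D → ℤ) (e : ↔Arc D) →
  y* D π (vin (↔tail D e)) + y* D π (vout (↔tail D e))
    ≡ Δ D π (uov e) + Δ D π (uvi (↔reverse D e))
y*-vertical-sum≡Δ-return-path D π e
  rewrite ↔tail-reverse D e | ↔head-reverse D e =
    four-cycle-telescopes (π (inn v)) (π (mid v)) (π (out v)) (π (mid (↔head D e)))
  where v = ↔tail D e

y*-vertical-sum≤1 : (D : Digraph) (π : V* D → ℤ) → Feasible D π → (e : ↔Arc D) →
  y* D π (vin (↔tail D e)) + y* D π (vout (↔tail D e)) ≤ℤ + 1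
y*-vertical-sum≤1 D π feasible e = begin
  y* D π (vin (↔tail D e)) + y* D π (vout (↔tail D e))
    ≡⟨ y*-vertical-sum≡Δ-return-path D π e ⟩
  Δ D π (uov e) + Δ D π (uvi e′)
    ≤⟨ +-mono-≤ (feasible (uov e)) (feasible (uvi e′)) ⟩
  ↔cost D e + ↔cost D e′
    ≡⟨ ↔cost-+-↔cost-reverse D e ⟩
  + 1 ∎
  where
  open ≤-Reasoning
  e′ = ↔reverse D e

claim4p3 : (D : Digraph) → Loopless D → WeaklyConnected D → 2 ≤ n D →
    (π : V* D → ℤ) → Feasible D π → (v : Fin (n D)) →
    In01 (y* D π (vin v) + y* D π (vout v)) × In01 (y* D π (vin v)) × In01 (y* D π (vout v))
claim4p3 D _ connected 2≤n π feasible v with ∃-↔Arc-from D connected 2≤n v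
... | e , refl =
  nonneg-sum≤1⇒In01 (y*-nonneg D π feasible (vin v)) (y*-nonneg D π feasible (vout v))
    (y*-vertical-sum≤1 D π feasible e)
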